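{- If $r\ge 2$, then $\mathrm{gp}(GT(r))=2^r$.
   Context: The glued binary tree $GT(r)$, $r\ge 2$, is obtained from two copies of the complete binary tree of depth $r$ (which has $2^r$ leaves) by pairwise identifying their leaves (via a bijection between the leaf sets matching corresponding leaves). For a connected graph $G$, a set $S\subseteq V(G)$ is a general position set if no three distinct vertices of $S$ lie on a common geodesic (shortest path) of $G$; $\mathrm{gp}(G)$ is the maximum cardinality of a general position set of $G$. -}

module Defs where

open import Level using (Level; _⊔_) renaming (suc to lsuc)
open import Data.Nat using (ℕ; zero; suc; _≤_; _<_)
open import Data.Bool using (Bool)
open import Data.List using (List; []; _∷_; length)
open import Data.List.Membership.Propositional using (_∈_)
open import Data.List.Relation.Unary.Unique.Propositional using (Unique)
open import Data.Product using (Σ; ∃; _×_; _,_)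
open import Relation.Binary.PropositionalEquality using (_≡_; _≢_)
open import Relation.Nullary using (¬_)

-- Generic graph notions: a graph is a vertex type V with an edge
-- relation E (for an undirected graph E is symmetric).

module _ {a e : Level} {V : Set a} (E : V → V → Set e) where

  data Walk : V → V → Set (a ⊔ e) where
    [] : ∀ {u} → Walk u u
    _∷_ : ∀ {u w v} → E u w → Walk w v → Walk u v

  len : ∀ {u v} → Walk u v → ℕ
  len [] = 0
  len (_ ∷ p) = suc (len p)

  data OnWalk (x : V) : ∀ {u v} → Walk u v → Set (a ⊔ e) where
    here  : ∀ {u v} {p : Walk u v} → x ≡ u → OnWalk x p
    there : ∀ {u w v} {ed : E u w} {p : Walk w v} → OnWalk x p → OnWalk x (ed ∷ p)

  IsGeodesic : ∀ {u v} → Walk u v → Set (a ⊔ e)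
  IsGeodesic {u} {v} p = ∀ (q : Walk u v) → len p ≤ len q

  OnCommonGeodesic : V → V → V → Set (a ⊔ e)
  OnCommonGeodesic x y z =
    Σ V λ u → Σ V λ v → Σ (Walk u v) λ p →
      IsGeodesic p × OnWalk x p × OnWalk y p × OnWalk z p

  IsGPSet : List V → Set (a ⊔ e)
  IsGPSet S = Unique S ×
    (∀ {x y z} → x ∈ S → y ∈ S → z ∈ S →
       x ≢ y → y ≢ z → x ≢ z → ¬ OnCommonGeodesic x y z)

  GPNumber : ℕ → Set (a ⊔ e)
  GPNumber n =
    (Σ (List V) λ S → IsGPSet S × length S ≡ n) ×
    (∀ (S : List V) → IsGPSet S → length S ≤ n)

-- A vertex of the complete binary tree of depth r is a binary word w
-- (List Bool) of length ≤ r; the children of w are b ∷ w.  GT(r) has the non-leaf vertices of two copies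
-- (tagged by a Bool) and one shared copy of the leaves (leaves of the two
-- trees with the same word are identified).

data GTVertex (r : ℕ) : Set where
  inner : (c : Bool) (w : List Bool) → length w < r → GTVertex r
  leaf  : (w : List Bool) → length w ≡ r → GTVertex r

-- edges of GT(r) (both orientations, so the graph is undirected)
data GTEdge {r : ℕ} : GTVertex r → GTVertex r → Set where
  down     : ∀ {c w b p q} → GTEdge (inner c w p) (inner c (b ∷ w) q)
  up       : ∀ {c w b p q} → GTEdge (inner c (b ∷ w) q) (inner c w p)
  toLeaf   : ∀ {c w b p q} → GTEdge (inner c w p) (leaf (b ∷ w) q)
  fromLeaf : ∀ {c w b p q} → GTEdge (leaf (b ∷ w) q) (inner c w p)

-- Leaves: the map forgetting the copy sends GT(r) onto one binary tree without lengthening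
-- walks, and since the tree metric is an ultrametric on leaves, distinct leaves satisfy
-- d(x,z) < d(x,y) + d(y,z); as x and z are also joined in GT(r) by a walk of length d(x,z),
-- no geodesic passes through three leaves.  Upper bound: for a copy c and a word y of length
-- r - 1, the spine from the leaf c ∷ y up to the root of copy c and down to the leaf
-- c ∷ map not y is a geodesic, as the two leaves have only the root as common ancestor.  The
-- 2^(r-1) spines, one per copy and pair {y, map not y}, cover GT(r), and a general position
-- set meets each of them in at most two vertices.
module Submission where

open import Defs
open import Data.Nat using (ℕ; _≤_; _^_)
open import Level using (Level; _⊔_)
open import Data.Nat using (zero; suc; _+_; _*_; _∸_; _<_; z≤n; s≤s)
open import Data.Nat.Properties
  using (≤-refl; ≤-reflexive; ≤-trans; ≤-<-trans; ≤-total; ≤-pred; ≤-irrelevant; ≡-irrelevant; <-irrefl; <⇒≤; <⇒≢;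
         ≤∧≢⇒<; n≤1+n; suc-injective; m≤m+n; m<m+n; m<n+m; +-comm; +-suc; +-identityʳ; +-mono-≤; +-cancelˡ-≤;
         +-cancelʳ-≤; n∸n≡0; +-∸-assoc; m+n∸m≡n; m∸n+n≡m; ∸-monoʳ-≤; m<n⇒0<n∸m; module ≤-Reasoning)
open import Data.Bool using (Bool; true; false; not)
import Data.Bool as Bool
import Data.Bool.Properties as Bool
open import Data.List using (List; []; _∷_; [_]; length; _++_; _∷ʳ_; map; reverse; replicate; drop; filter)
open import Data.List.Properties
  using (≡-dec; ++-identityʳ; ∷-injectiveʳ; length-map; length-++; length-drop; length-replicate; length-reverse;
         map-∘; map-cong; map-id; unfold-reverse; reverse-map; reverse-++; reverse-involutive; reverse-injective)
open import Data.Vec using (Vec; toList)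
import Data.Vec.Properties as Vec
open import Data.List.Membership.Propositional using (_∈_)
open import Data.List.Membership.Propositional.Properties using (∈-filter⁻; ∈-map⁻)
open import Data.List.Relation.Unary.Any using (here; there)
open import Data.List.Relation.Unary.AllPairs using ([]; _∷_)
open import Data.List.Relation.Unary.All using ([]; _∷_)
open import Data.List.Relation.Unary.Unique.Propositional using (Unique)
open import Data.List.Relation.Unary.Unique.Propositional.Properties using (filter⁺; map⁺; ++⁺)
open import Data.Product using (Σ; _×_; _,_; proj₁; proj₂)
open import Data.Sum using (_⊎_; inj₁; inj₂)
open import Data.Empty using (⊥; ⊥-elim)
open import Function using (_∘_)
open import Relation.Binary.Definitions using (DecidableEquality)
open import Relation.Binary.PropositionalEquality
  using (_≡_; _≢_; refl; sym; trans; cong; cong₂; subst; subst₂; ≢-sym; module ≡-Reasoning)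
open import Relation.Nullary using (¬_; yes; no)
open import Relation.Unary using (Pred; Decidable)
open import Relation.Unary.Properties using (∁?)

module _ {a p} {A : Set a} {P : Pred A p} (P? : Decidable P) where

  length-filter-∁ : ∀ xs → length xs ≡ length (filter P? xs) + length (filter (∁? P?) xs)
  length-filter-∁ [] = refl
  length-filter-∁ (x ∷ xs) with P? x
  ... | yes _ = cong suc (length-filter-∁ xs)
  ... | no _ = trans (cong suc (length-filter-∁ xs)) (sym (+-suc _ _))

module _ {a} {A : Set a} where

  AtMostTwoPerFibre : ∀ {b} {B : Set b} → (A → B) → List A → Set (a ⊔ b)
  AtMostTwoPerFibre f S = ∀ {x y z} → x ∈ S → y ∈ S → z ∈ S →
    x ≢ y → y ≢ z → x ≢ z → f x ≡ f y → f y ≡ f z → ⊥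

  atMostTwoPerFibre-refine : ∀ {b c} {B : Set b} {C : Set c} {f : A → B} {g : A → C} {S S′} →
    (∀ {x} → x ∈ S′ → x ∈ S) → (∀ {x y} → x ∈ S′ → y ∈ S′ → g x ≡ g y → f x ≡ f y) →
    AtMostTwoPerFibre f S → AtMostTwoPerFibre g S′
  atMostTwoPerFibre-refine sub refine two xS yS zS x≢y y≢z x≢z e₁ e₂ =
    two (sub xS) (sub yS) (sub zS) x≢y y≢z x≢z (refine xS yS e₁) (refine yS zS e₂)

  length≤2-constant : ∀ {b} {B : Set b} {f : A → B} {S} → (∀ x y → f x ≡ f y) → Unique S →
                      AtMostTwoPerFibre f S → length S ≤ 2
  length≤2-constant {S = []} _ _ _ = z≤n
  length≤2-constant {S = _ ∷ []} _ _ _ = s≤s z≤n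
  length≤2-constant {S = _ ∷ _ ∷ []} _ _ _ = s≤s (s≤s z≤n)
  length≤2-constant {S = x ∷ y ∷ z ∷ _} const ((x≢y ∷ x≢z ∷ _) ∷ (y≢z ∷ _) ∷ _) two =
    ⊥-elim (two (here refl) (there (here refl)) (there (there (here refl))) x≢y y≢z x≢z
                (const x y) (const y z))

private
  []-unique : ∀ {l : List Bool} → length l ≡ 0 → l ≡ []
  []-unique {[]} _ = refl

  ≢false∷⇒≡true∷ : ∀ {n} (l : List Bool) → length l ≡ suc n → l ≢ false ∷ drop 1 l → l ≡ true ∷ drop 1 l
  ≢false∷⇒≡true∷ (false ∷ _) _ l≢ = ⊥-elim (l≢ refl)
  ≢false∷⇒≡true∷ (true ∷ _) _ _ = refl

pigeonhole-bits : ∀ {a} {A : Set a} n (f : A → List Bool) → (∀ x → length (f x) ≡ n) →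
                  ∀ {S} → Unique S → AtMostTwoPerFibre f S → length S ≤ 2 * 2 ^ n
pigeonhole-bits zero f length-f u two =
  length≤2-constant (λ x y → trans ([]-unique (length-f x)) (sym ([]-unique (length-f y)))) u two
pigeonhole-bits (suc n) f length-f {S} u two = begin
  length S                                                              ≡⟨ length-filter-∁ startsFalse? S ⟩
  length (filter startsFalse? S) + length (filter (∁? startsFalse?) S)  ≤⟨ +-mono-≤ (half startsFalse? (λ _ sf → sf))
                                                                             (half (∁? startsFalse?) startsTrue) ⟩
  2 * 2 ^ n + 2 * 2 ^ n                                                 ≡⟨ cong (2 * 2 ^ n +_) (+-identityʳ _) ⟨
  2 * 2 ^ suc n                                                         ∎
  where
  open ≤-Reasoning
  rest : _ → List Bool
  rest x = drop 1 (f x)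
  startsFalse? : Decidable (λ x → f x ≡ false ∷ rest x)
  startsFalse? x = ≡-dec Bool._≟_ (f x) (false ∷ rest x)
  startsTrue : ∀ x → f x ≢ false ∷ rest x → f x ≡ true ∷ rest x
  startsTrue x = ≢false∷⇒≡true∷ (f x) (length-f x)
  half : ∀ {p} {P : Pred _ p} (P? : Decidable P) {b} → (∀ x → P x → f x ≡ b ∷ rest x) →
         length (filter P? S) ≤ 2 * 2 ^ n
  half P? starts = pigeonhole-bits n rest (λ x → trans (length-drop 1 (f x)) (cong (_∸ 1) (length-f x)))
    (filter⁺ P? u) (atMostTwoPerFibre-refine (proj₁ ∘ ∈-filter⁻ P? {xs = S}) sameHead two)
    where
    sameHead : ∀ {x y} → x ∈ filter P? S → y ∈ filter P? S → rest x ≡ rest y → f x ≡ f y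
    sameHead {x} {y} xP yP e = trans (starts x (proj₂ (∈-filter⁻ P? {xs = S} xP)))
                                     (trans (cong (_ ∷_) e) (sym (starts y (proj₂ (∈-filter⁻ P? {xs = S} yP)))))

boolVecs : ∀ n → List (Vec Bool n)
boolVecs zero = [ Vec.[] ]
boolVecs (suc n) = map (false Vec.∷_) (boolVecs n) ++ map (true Vec.∷_) (boolVecs n)

length-boolVecs : ∀ n → length (boolVecs n) ≡ 2 ^ n
length-boolVecs zero = refl
length-boolVecs (suc n) = begin
  length (boolVecs (suc n))                  ≡⟨ length-++ (map (false Vec.∷_) (boolVecs n)) ⟩
  length (map _ (boolVecs n)) + length (map _ (boolVecs n))
                                             ≡⟨ cong₂ _+_ (length-map _ (boolVecs n)) (length-map _ (boolVecs n)) ⟩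
  length (boolVecs n) + length (boolVecs n)  ≡⟨ cong₂ _+_ (length-boolVecs n) (length-boolVecs n) ⟩
  2 ^ n + 2 ^ n                              ≡⟨ cong (2 ^ n +_) (+-identityʳ _) ⟨
  2 ^ suc n                                  ∎
  where open ≡-Reasoning

boolVecs-unique : ∀ n → Unique (boolVecs n)
boolVecs-unique zero = [] ∷ []
boolVecs-unique (suc n) =
  ++⁺ (map⁺ Vec.∷-injectiveʳ (boolVecs-unique n)) (map⁺ Vec.∷-injectiveʳ (boolVecs-unique n)) disjoint
  where
  disjoint : ∀ {v} → ¬ (v ∈ map (false Vec.∷_) (boolVecs n) × v ∈ map (true Vec.∷_) (boolVecs n))
  disjoint (v∈F , v∈T) with ∈-map⁻ _ v∈F | ∈-map⁻ _ v∈T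
  ... | _ , _ , refl | _ , _ , ()

-- Walks, geodesics and betweenness

module WalkProperties {a e : Level} {V : Set a} (E : V → V → Set e) where

  infixr 5 _++ʷ_

  _++ʷ_ : ∀ {u w v} → Walk E u w → Walk E w v → Walk E u v
  [] ++ʷ q = q
  (x ∷ p) ++ʷ q = x ∷ (p ++ʷ q)

  ≡⇒walk : ∀ {u v} → u ≡ v → Walk E u v
  ≡⇒walk refl = []

  len-≡⇒walk : ∀ {u v} (u≡v : u ≡ v) → len E (≡⇒walk u≡v) ≡ 0
  len-≡⇒walk refl = refl

  onWalk-end : ∀ {x u v} (p : Walk E u v) → x ≡ v → OnWalk E x p
  onWalk-end [] x≡v = here x≡v
  onWalk-end (_ ∷ p) x≡v = there (onWalk-end p x≡v)

  len-++ʷ : ∀ {u w v} (p : Walk E u w) (q : Walk E w v) → len E (p ++ʷ q) ≡ len E p + len E q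
  len-++ʷ [] q = refl
  len-++ʷ (x ∷ p) q = cong suc (len-++ʷ p q)

  ++ʷ-assoc : ∀ {u w x v} (p : Walk E u w) (q : Walk E w x) (s : Walk E x v) →
              (p ++ʷ q) ++ʷ s ≡ p ++ʷ (q ++ʷ s)
  ++ʷ-assoc [] q s = refl
  ++ʷ-assoc (x ∷ p) q s = cong (x ∷_) (++ʷ-assoc p q s)

  onWalk-++⁺ˡ : ∀ {x u w v} {p : Walk E u w} (q : Walk E w v) → OnWalk E x p → OnWalk E x (p ++ʷ q)
  onWalk-++⁺ˡ q (here eq) = here eq
  onWalk-++⁺ˡ q (there o) = there (onWalk-++⁺ˡ q o)

  onWalk-++⁺ʳ : ∀ {x u w v} (p : Walk E u w) {q : Walk E w v} → OnWalk E x q → OnWalk E x (p ++ʷ q)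
  onWalk-++⁺ʳ [] o = o
  onWalk-++⁺ʳ (x ∷ p) o = there (onWalk-++⁺ʳ p o)

  onWalk-++⁻ : ∀ {x u w v} (p : Walk E u w) {q : Walk E w v} → OnWalk E x (p ++ʷ q) →
               OnWalk E x p ⊎ OnWalk E x q
  onWalk-++⁻ [] o = inj₂ o
  onWalk-++⁻ (x ∷ p) (here eq) = inj₁ (here eq)
  onWalk-++⁻ (x ∷ p) (there o) with onWalk-++⁻ p o
  ... | inj₁ o′ = inj₁ (there o′)
  ... | inj₂ o′ = inj₂ o′

  onWalk-split : ∀ {x u v} {p : Walk E u v} → OnWalk E x p →
                 Σ (Walk E u x) λ p₁ → Σ (Walk E x v) λ p₂ → p ≡ p₁ ++ʷ p₂
  onWalk-split {p = p} (here refl) = [] , p , refl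
  onWalk-split {p = ed ∷ p} (there o) with onWalk-split o
  ... | p₁ , p₂ , refl = ed ∷ p₁ , p₂ , refl

  Infix : ∀ {x y u v} → Walk E x y → Walk E u v → Set (a ⊔ e)
  Infix {x} {y} {u} {v} s p = Σ (Walk E u x) λ pre → Σ (Walk E y v) λ post → p ≡ pre ++ʷ (s ++ʷ post)

  infix-geodesic : ∀ {x y u v} {s : Walk E x y} {p : Walk E u v} → IsGeodesic E p → Infix s p →
                   IsGeodesic E s
  infix-geodesic {s = s} g (pre , post , refl) q =
    +-cancelʳ-≤ (len E post) (len E s) (len E q)
      (+-cancelˡ-≤ (len E pre) _ _
        (subst₂ _≤_ (len-pre-mid-post s) (len-pre-mid-post q) (g (pre ++ʷ (q ++ʷ post)))))
    where
    len-pre-mid-post : (m : Walk E _ _) → len E (pre ++ʷ (m ++ʷ post)) ≡ len E pre + (len E m + len E post)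
    len-pre-mid-post m = trans (len-++ʷ pre _) (cong (len E pre +_) (len-++ʷ m post))

  InOrder : ∀ {u v} → Walk E u v → V → V → V → Set (a ⊔ e)
  InOrder p x y z = Σ (Walk E x y) λ m₁ → Σ (Walk E y z) λ m₂ → Infix (m₁ ++ʷ m₂) p

  onWalk-precedes : ∀ {x y u v} {p : Walk E u v} → OnWalk E x p → OnWalk E y p →
                    (Σ (Walk E x y) λ m → Infix m p) ⊎ (Σ (Walk E y x) λ m → Infix m p)
  onWalk-precedes ox oy with onWalk-split ox
  ... | p₁ , p₂ , refl with onWalk-++⁻ p₁ oy
  ...   | inj₂ oy₂ with onWalk-split oy₂
  ...     | m , post , refl = inj₁ (m , p₁ , post , refl)
  onWalk-precedes ox oy | p₁ , p₂ , refl | inj₁ oy₁ with onWalk-split oy₁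
  ...     | pre , m , refl = inj₂ (m , pre , p₂ , ++ʷ-assoc pre m p₂)

  infix-inOrder : ∀ {x y z u v} {p : Walk E u v} (m : Walk E x y) → Infix m p → OnWalk E z p →
                  InOrder p z x y ⊎ InOrder p x z y ⊎ InOrder p x y z
  infix-inOrder m (pre , post , refl) oz with onWalk-++⁻ pre oz
  ... | inj₁ oz₁ with onWalk-split oz₁
  ...   | r₁ , r₂ , refl = inj₁ (r₂ , m , r₁ , post ,
            trans (++ʷ-assoc r₁ r₂ _) (cong (r₁ ++ʷ_) (sym (++ʷ-assoc r₂ m post))))
  infix-inOrder m (pre , post , refl) oz | inj₂ oz₂ with onWalk-++⁻ m oz₂
  ... | inj₁ ozm with onWalk-split ozm
  ...   | m₁ , m₂ , refl = inj₂ (inj₁ (m₁ , m₂ , pre , post , refl))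
  infix-inOrder m (pre , post , refl) oz | inj₂ oz₂ | inj₂ ozp with onWalk-split ozp
  ...   | s₁ , s₂ , refl = inj₂ (inj₂ (m , s₁ , pre , s₂ , cong (pre ++ʷ_) (sym (++ʷ-assoc m s₁ s₂))))

  Between : V → V → V → Set (a ⊔ e)
  Between x y z = Σ (Walk E x y) λ m₁ → Σ (Walk E y z) λ m₂ → IsGeodesic E (m₁ ++ʷ m₂)

  inOrder-between : ∀ {x y z u v} {p : Walk E u v} → IsGeodesic E p → InOrder p x y z → Between x y z
  inOrder-between g (m₁ , m₂ , inf) = m₁ , m₂ , infix-geodesic g inf

  gpSet-fromNoBetween : ∀ S → Unique S →
    (∀ {x y z} → x ∈ S → y ∈ S → z ∈ S → x ≢ y → y ≢ z → x ≢ z → ¬ Between x y z) → IsGPSet E S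
  gpSet-fromNoBetween S uniq noBetween = uniq , noCommonGeodesic
    where
    noCommonGeodesic : ∀ {x y z} → x ∈ S → y ∈ S → z ∈ S → x ≢ y → y ≢ z → x ≢ z →
                       ¬ OnCommonGeodesic E x y z
    noCommonGeodesic xS yS zS x≢y y≢z x≢z (_ , _ , _ , g , ox , oy , oz) with onWalk-precedes ox oy
    ... | inj₁ (m , inf) with infix-inOrder m inf oz
    ...   | inj₁ o = noBetween zS xS yS (≢-sym x≢z) x≢y (≢-sym y≢z) (inOrder-between g o)
    ...   | inj₂ (inj₁ o) = noBetween xS zS yS x≢z (≢-sym y≢z) x≢y (inOrder-between g o)
    ...   | inj₂ (inj₂ o) = noBetween xS yS zS x≢y y≢z x≢z (inOrder-between g o)
    noCommonGeodesic xS yS zS x≢y y≢z x≢z (_ , _ , _ , g , ox , oy , oz) | inj₂ (m , inf)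
      with infix-inOrder m inf oz
    ...   | inj₁ o = noBetween zS yS xS (≢-sym y≢z) (≢-sym x≢y) (≢-sym x≢z) (inOrder-between g o)
    ...   | inj₂ (inj₁ o) = noBetween yS zS xS y≢z (≢-sym x≢z) (≢-sym x≢y) (inOrder-between g o)
    ...   | inj₂ (inj₂ o) = noBetween yS xS zS (≢-sym x≢y) x≢z y≢z (inOrder-between g o)

  module _ (E-sym : ∀ {u v} → E u v → E v u) where

    reverseʷ : ∀ {u v} → Walk E u v → Walk E v u
    reverseʷ [] = []
    reverseʷ (x ∷ p) = reverseʷ p ++ʷ (E-sym x ∷ [])

    len-reverseʷ : ∀ {u v} (p : Walk E u v) → len E (reverseʷ p) ≡ len E p
    len-reverseʷ [] = refl
    len-reverseʷ (x ∷ p) = trans (len-++ʷ (reverseʷ p) _) (trans (+-comm _ 1) (cong suc (len-reverseʷ p)))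

    onWalk-reverseʷ : ∀ {x u v} {p : Walk E u v} → OnWalk E x p → OnWalk E x (reverseʷ p)
    onWalk-reverseʷ {p = _ ∷ p} (here eq) = onWalk-++⁺ʳ (reverseʷ p) (there (here eq))
    onWalk-reverseʷ {p = _ ∷ _} (there o) = onWalk-++⁺ˡ _ (onWalk-reverseʷ o)
    onWalk-reverseʷ {p = []} (here eq) = here eq

  gpSet-atMostTwoPerFibre : ∀ {i} {I : Set i} (f : V → I) →
    (∀ {x y z} → f x ≡ f y → f y ≡ f z → OnCommonGeodesic E x y z) →
    ∀ {S} → IsGPSet E S → AtMostTwoPerFibre f S
  gpSet-atMostTwoPerFibre f fibre-onGeodesic (_ , gp) xS yS zS x≢y y≢z x≢z e₁ e₂ =
    gp xS yS zS x≢y y≢z x≢z (fibre-onGeodesic e₁ e₂)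

-- Distance in a tree of words

module TreeDistance {a} {A : Set a} (_≟_ : DecidableEquality A) where

  lcp : List A → List A → ℕ
  lcp [] _ = 0
  lcp (_ ∷ _) [] = 0
  lcp (x ∷ u) (y ∷ v) with x ≟ y
  ... | yes _ = suc (lcp u v)
  ... | no _ = 0

  lcp≤ˡ : ∀ u v → lcp u v ≤ length u
  lcp≤ˡ [] _ = z≤n
  lcp≤ˡ (_ ∷ _) [] = z≤n
  lcp≤ˡ (x ∷ u) (y ∷ v) with x ≟ y
  ... | yes _ = s≤s (lcp≤ˡ u v)
  ... | no _ = z≤n

  lcp≤ʳ : ∀ u v → lcp u v ≤ length v
  lcp≤ʳ [] _ = z≤n
  lcp≤ʳ (_ ∷ _) [] = z≤n
  lcp≤ʳ (x ∷ u) (y ∷ v) with x ≟ y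
  ... | yes _ = s≤s (lcp≤ʳ u v)
  ... | no _ = z≤n

  lcp-refl : ∀ u → lcp u u ≡ length u
  lcp-refl [] = refl
  lcp-refl (x ∷ u) with x ≟ x
  ... | yes _ = cong suc (lcp-refl u)
  ... | no x≢x = ⊥-elim (x≢x refl)

  lcp-∷ʳ : ∀ u b v → lcp (u ∷ʳ b) v ≡ lcp u v ⊎ lcp (u ∷ʳ b) v ≡ suc (lcp u v)
  lcp-∷ʳ [] b [] = inj₁ refl
  lcp-∷ʳ [] b (y ∷ v) with b ≟ y
  ... | yes _ = inj₂ refl
  ... | no _ = inj₁ refl
  lcp-∷ʳ (_ ∷ _) b [] = inj₁ refl
  lcp-∷ʳ (x ∷ u) b (y ∷ v) with x ≟ y
  ... | no _ = inj₁ refl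
  ... | yes _ with lcp-∷ʳ u b v
  ...   | inj₁ e = inj₁ (cong suc e)
  ...   | inj₂ e = inj₂ (cong suc e)

  lcp-ultrametric : ∀ n u v w → n ≤ lcp u v → n ≤ lcp v w → n ≤ lcp u w
  lcp-ultrametric zero _ _ _ _ _ = z≤n
  lcp-ultrametric (suc n) [] _ _ () _
  lcp-ultrametric (suc n) (_ ∷ _) [] _ () _
  lcp-ultrametric (suc n) (_ ∷ _) (_ ∷ _) [] _ ()
  lcp-ultrametric (suc n) (x ∷ u) (y ∷ v) (z ∷ w) n<uv n<vw with x ≟ y | y ≟ z
  lcp-ultrametric (suc n) (x ∷ u) (y ∷ v) (z ∷ w) () _ | no _ | _
  lcp-ultrametric (suc n) (x ∷ u) (y ∷ v) (z ∷ w) _ () | yes _ | no _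
  lcp-ultrametric (suc n) (x ∷ u) (y ∷ v) (z ∷ w) n<uv n<vw | yes refl | yes refl with x ≟ x
  ...   | yes _ = s≤s (lcp-ultrametric n u v w (≤-pred n<uv) (≤-pred n<vw))
  ...   | no x≢x = ⊥-elim (x≢x refl)

  lcp-≡ : ∀ u v → lcp u v ≡ length u → length u ≡ length v → u ≡ v
  lcp-≡ [] [] _ _ = refl
  lcp-≡ (x ∷ u) (y ∷ v) e l with x ≟ y
  ... | yes refl = cong (x ∷_) (lcp-≡ u v (suc-injective e) (suc-injective l))

  lcp-commonPrefix : ∀ u v → Σ (List A) λ P → Σ (List A) λ U → Σ (List A) λ W →
                     u ≡ P ++ U × v ≡ P ++ W × length P ≡ lcp u v
  lcp-commonPrefix [] v = [] , [] , v , refl , refl , refl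
  lcp-commonPrefix (x ∷ u) [] = [] , x ∷ u , [] , refl , refl , refl
  lcp-commonPrefix (x ∷ u) (y ∷ v) with x ≟ y
  ... | no _ = [] , x ∷ u , y ∷ v , refl , refl , refl
  ... | yes refl with lcp-commonPrefix u v
  ...   | P , U , W , refl , refl , e = x ∷ P , U , W , refl , refl , cong suc e

  -- A word lists a vertex's letters from the vertex up to the root, so common ancestors
  -- are common suffixes.
  ancestorDepth : List A → List A → ℕ
  ancestorDepth x y = lcp (reverse x) (reverse y)

  treeDist : List A → List A → ℕ
  treeDist x y = (length x ∸ ancestorDepth x y) + (length y ∸ ancestorDepth x y)

  ancestorDepth≤ˡ : ∀ x y → ancestorDepth x y ≤ length x
  ancestorDepth≤ˡ x y = subst (ancestorDepth x y ≤_) (length-reverse x) (lcp≤ˡ (reverse x) (reverse y))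

  ancestorDepth≤ʳ : ∀ x y → ancestorDepth x y ≤ length y
  ancestorDepth≤ʳ x y = subst (ancestorDepth x y ≤_) (length-reverse y) (lcp≤ʳ (reverse x) (reverse y))

  treeDist-refl : ∀ x → treeDist x x ≡ 0
  treeDist-refl x rewrite lcp-refl (reverse x) | length-reverse x | n∸n≡0 (length x) = refl

  ancestorDepth-∷ : ∀ b w y → ancestorDepth (b ∷ w) y ≡ ancestorDepth w y ⊎
                               ancestorDepth (b ∷ w) y ≡ suc (ancestorDepth w y)
  ancestorDepth-∷ b w y rewrite unfold-reverse b w = lcp-∷ʳ (reverse w) b (reverse y)

  treeDist-∷ : ∀ b w y → treeDist (b ∷ w) y ≡ suc (treeDist w y) ⊎ suc (treeDist (b ∷ w) y) ≡ treeDist w y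
  treeDist-∷ b w y with ancestorDepth-∷ b w y
  ... | inj₁ e = inj₁ (trans (cong (λ d → (suc (length w) ∸ d) + (length y ∸ d)) e)
                             (cong (_+ (length y ∸ ancestorDepth w y)) (+-∸-assoc 1 (ancestorDepth≤ˡ w y))))
  ... | inj₂ e = inj₂ (trans (cong (λ d → suc ((suc (length w) ∸ d) + (length y ∸ d))) e)
                        (trans (sym (+-suc _ _)) (cong ((length w ∸ ancestorDepth w y) +_) (sym (+-∸-assoc 1 d<|y|)))))
    where
    d<|y| : suc (ancestorDepth w y) ≤ length y
    d<|y| = subst (_≤ length y) e (ancestorDepth≤ʳ (b ∷ w) y)

  treeDist-∷-≤ : ∀ b w y → treeDist (b ∷ w) y ≤ suc (treeDist w y)
  treeDist-∷-≤ b w y with treeDist-∷ b w y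
  ... | inj₁ e = ≤-reflexive e
  ... | inj₂ e = ≤-trans (n≤1+n _) (≤-trans (≤-reflexive e) (n≤1+n _))

  treeDist-≤-∷ : ∀ b w y → treeDist w y ≤ suc (treeDist (b ∷ w) y)
  treeDist-≤-∷ b w y with treeDist-∷ b w y
  ... | inj₁ e = ≤-trans (n≤1+n _) (≤-trans (n≤1+n _) (≤-reflexive (cong suc (sym e))))
  ... | inj₂ e = ≤-reflexive (sym e)

  treeDist-sameLength : ∀ {n x y} → length x ≡ n → length y ≡ n →
                        treeDist x y ≡ (n ∸ ancestorDepth x y) + (n ∸ ancestorDepth x y)
  treeDist-sameLength refl ly rewrite ly = refl

  ancestorDepth<length : ∀ {n x y} → length x ≡ n → length y ≡ n → x ≢ y → ancestorDepth x y < n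
  ancestorDepth<length {n} {x} {y} lx ly x≢y =
    ≤∧≢⇒< (subst (ancestorDepth x y ≤_) lx (ancestorDepth≤ˡ x y)) d≢n
    where
    |rx| : length (reverse x) ≡ n
    |rx| = trans (length-reverse x) lx
    d≢n : ancestorDepth x y ≢ n
    d≢n d≡n = x≢y (reverse-injective (lcp-≡ (reverse x) (reverse y) (trans d≡n (sym |rx|))
                                        (trans |rx| (sym (trans (length-reverse y) ly)))))

  treeDist-antitone : ∀ {n u v u′ v′} → length u ≡ n → length v ≡ n → length u′ ≡ n → length v′ ≡ n →
                      ancestorDepth u v ≤ ancestorDepth u′ v′ → treeDist u′ v′ ≤ treeDist u v
  treeDist-antitone {n} {u} {v} {u′} {v′} lu lv lu′ lv′ d≤d′ =
    subst₂ _≤_ (sym (treeDist-sameLength {x = u′} {v′} lu′ lv′)) (sym (treeDist-sameLength {x = u} {v} lu lv))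
      (+-mono-≤ h≤h h≤h)
    where
    h≤h : n ∸ ancestorDepth u′ v′ ≤ n ∸ ancestorDepth u v
    h≤h = ∸-monoʳ-≤ n d≤d′

  treeDist-pos : ∀ {n x y} → length x ≡ n → length y ≡ n → x ≢ y → 0 < treeDist x y
  treeDist-pos {x = x} {y} lx ly x≢y = subst (0 <_) (sym (treeDist-sameLength {x = x} {y} lx ly))
    (≤-trans (m<n⇒0<n∸m (ancestorDepth<length {x = x} {y} lx ly x≢y)) (m≤m+n _ _))

  treeDist-strictTriangle : ∀ {n x y z} → length x ≡ n → length y ≡ n → length z ≡ n → x ≢ y → y ≢ z →
                            treeDist x z < treeDist x y + treeDist y z
  treeDist-strictTriangle {x = x} {y} {z} lx ly lz x≢y y≢z with ≤-total (ancestorDepth x y) (ancestorDepth y z)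
  ... | inj₁ xy≤yz = ≤-<-trans (treeDist-antitone {u = x} {y} {x} {z} lx ly lx lz xy≤xz)
                               (m<m+n _ (treeDist-pos {x = y} {z} ly lz y≢z))
    where
    xy≤xz : ancestorDepth x y ≤ ancestorDepth x z
    xy≤xz = lcp-ultrametric _ (reverse x) (reverse y) (reverse z) ≤-refl xy≤yz
  ... | inj₂ yz≤xy = ≤-<-trans (treeDist-antitone {u = y} {z} {x} {z} ly lz lx lz yz≤xz)
                               (m<n+m _ (treeDist-pos {x = x} {y} lx ly x≢y))
    where
    yz≤xz : ancestorDepth y z ≤ ancestorDepth x z
    yz≤xz = lcp-ultrametric _ (reverse x) (reverse y) (reverse z) yz≤xy ≤-refl

  commonAncestor : ∀ x y → Σ (List A) λ P → Σ (List A) λ U → Σ (List A) λ W →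
                   x ≡ U ++ P × y ≡ W ++ P × length P ≡ ancestorDepth x y ×
                   treeDist x y ≡ length U + length W
  commonAncestor x y with lcp-commonPrefix (reverse x) (reverse y)
  ... | P , U , W , rx , ry , |P| =
    reverse P , reverse U , reverse W , unreverse x rx , unreverse y ry ,
    trans (length-reverse P) |P| , cong₂ _+_ (height x rx) (height y ry)
    where
    unreverse : ∀ v {V} → reverse v ≡ P ++ V → v ≡ reverse V ++ reverse P
    unreverse v {V} e = trans (sym (reverse-involutive v)) (trans (cong reverse e) (reverse-++ P V))
    height : ∀ v {V} → reverse v ≡ P ++ V → length v ∸ ancestorDepth x y ≡ length (reverse V)
    height v {V} e = begin
      length v ∸ ancestorDepth x y
        ≡⟨ cong₂ _∸_ (trans (sym (length-reverse v)) (trans (cong length e) (length-++ P))) (sym |P|) ⟩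
      (length P + length V) ∸ length P ≡⟨ m+n∸m≡n (length P) (length V) ⟩
      length V                         ≡⟨ sym (length-reverse V) ⟩
      length (reverse V)               ∎
      where open ≡-Reasoning

map-not-involutive : ∀ t → map not (map not t) ≡ t
map-not-involutive t = trans (sym (map-∘ t)) (trans (map-cong Bool.not-involutive t) (map-id t))

canonicalTail : List Bool → List Bool
canonicalTail [] = []
canonicalTail (false ∷ t) = t
canonicalTail (true ∷ t) = map not t

length-canonicalTail : ∀ {n} y → length y ≡ suc n → length (canonicalTail y) ≡ n
length-canonicalTail (false ∷ t) e = suc-injective e
length-canonicalTail (true ∷ t) e = trans (length-map not t) (suc-injective e)

canonicalTail-spec : ∀ {n} y → length y ≡ suc n →
                     y ≡ false ∷ canonicalTail y ⊎ y ≡ map not (false ∷ canonicalTail y)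
canonicalTail-spec (false ∷ t) _ = inj₁ refl
canonicalTail-spec (true ∷ t) _ = inj₂ (cong (true ∷_) (sym (map-not-involutive t)))

module _ where
  open TreeDistance Bool._≟_

  lcp-map-not : ∀ u w w′ → 0 < length u → lcp (u ++ w) (map not u ++ w′) ≡ 0
  lcp-map-not (false ∷ _) _ _ _ = refl
  lcp-map-not (true ∷ _) _ _ _ = refl

  ancestorDepth-map-not : ∀ c y → 0 < length y → ancestorDepth (c ∷ y) (c ∷ map not y) ≡ 0
  ancestorDepth-map-not c y 0<|y|
    rewrite unfold-reverse c y | unfold-reverse c (map not y) | sym (reverse-map not y) =
    lcp-map-not (reverse y) _ _ (subst (0 <_) (sym (length-reverse y)) 0<|y|)

-- The glued binary tree

module GluedTree (r : ℕ) where

  V : Set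
  V = GTVertex r

  E : V → V → Set
  E = GTEdge {r}

  open WalkProperties E
  open TreeDistance Bool._≟_

  word : V → List Bool
  word (inner _ w _) = w
  word (leaf w _) = w

  E-sym : ∀ {u v} → E u v → E v u
  E-sym down = up
  E-sym up = down
  E-sym toLeaf = fromLeaf
  E-sym fromLeaf = toLeaf

  inner-≡ : ∀ {c w w′} {p : length w < r} {p′ : length w′ < r} → w ≡ w′ → inner c w p ≡ inner c w′ p′
  inner-≡ refl = cong (inner _ _) (≤-irrelevant _ _)

  leaf-≡ : ∀ {w w′} {q : length w ≡ r} {q′ : length w′ ≡ r} → w ≡ w′ → leaf w q ≡ leaf w′ q′
  leaf-≡ refl = cong (leaf _) (≡-irrelevant _ _)

  treeDist-edge : ∀ {s t} → E s t → ∀ y → treeDist (word s) y ≤ suc (treeDist (word t) y)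
  treeDist-edge (down {w = w} {b = b}) y = treeDist-≤-∷ b w y
  treeDist-edge (up {w = w} {b = b}) y = treeDist-∷-≤ b w y
  treeDist-edge (toLeaf {w = w} {b = b}) y = treeDist-≤-∷ b w y
  treeDist-edge (fromLeaf {w = w} {b = b}) y = treeDist-∷-≤ b w y

  treeDist≤len : ∀ {s t} (q : Walk E s t) → treeDist (word s) (word t) ≤ len E q
  treeDist≤len {s} [] = ≤-reflexive (treeDist-refl (word s))
  treeDist≤len {t = t} (ed ∷ q) = ≤-trans (treeDist-edge ed (word t)) (s≤s (treeDist≤len q))

  -- The lower word is given as u with a ++ s ≡ u, so that callers need not rewrite it
  -- (e.g. y ++ [] to y).
  ascend : ∀ c a s {u} {p : length u < r} {q : length s < r} → a ++ s ≡ u →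
           Walk E (inner c u p) (inner c s q)
  ascend c [] s refl = ≡⇒walk (inner-≡ refl)
  ascend c (b ∷ a) s {p = p} refl = up ∷ ascend c a s {p = <⇒≤ p} refl

  len-ascend : ∀ c a s {u p q} (eq : a ++ s ≡ u) → len E (ascend c a s {p = p} {q} eq) ≡ length a
  len-ascend c [] s refl = len-≡⇒walk _
  len-ascend c (b ∷ a) s refl = cong suc (len-ascend c a s refl)

  ascend-visits : ∀ {c} a {s u p q} (eq : a ++ s ≡ u) a₁ {a₂ w q′} → a ≡ a₁ ++ a₂ → w ≡ a₂ ++ s →
                  OnWalk E (inner c w q′) (ascend c a s {p = p} {q} eq)
  ascend-visits a refl [] refl refl = here (inner-≡ refl)
  ascend-visits (b ∷ a) refl (_ ∷ a₁) e refl = there (ascend-visits a refl a₁ (∷-injectiveʳ e) refl)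

  climb : ∀ c {b} a s {u q p} → a ++ s ≡ u → Walk E (leaf (b ∷ u) q) (inner c s p)
  climb c a s {q = q} eq = fromLeaf {p = ≤-reflexive q} ∷ ascend c a s eq

  len-climb : ∀ c {b} a s {u q p} (eq : a ++ s ≡ u) →
              len E (climb c {b} a s {q = q} {p} eq) ≡ suc (length a)
  len-climb c a s eq = cong suc (len-ascend c a s eq)

  climb-visits : ∀ {c b} a {s u q p} (eq : a ++ s ≡ u) a₁ {a₂ w q′} → a ≡ a₁ ++ a₂ → w ≡ a₂ ++ s →
                 OnWalk E (inner c w q′) (climb c {b} a s {q = q} {p} eq)
  climb-visits a eq a₁ e₁ e₂ = there (ascend-visits a eq a₁ e₁ e₂)

  leafShortcut : ∀ {x z} (lx : length x ≡ r) (lz : length z ≡ r) → x ≢ z →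
                 Σ (Walk E (leaf x lx) (leaf z lz)) λ q → len E q ≡ treeDist x z
  leafShortcut {x} {z} lx lz x≢z with commonAncestor x z
  ... | P , [] , _ , refl , _ , |P| , _ = ⊥-elim (<⇒≢ (ancestorDepth<length lx lz x≢z) (trans (sym |P|) lx))
  ... | P , _ ∷ _ , [] , _ , refl , |P| , _ = ⊥-elim (<⇒≢ (ancestorDepth<length lx lz x≢z) (trans (sym |P|) lz))
  ... | P , α ∷ U , β ∷ W , refl , refl , |P| , dist =
    fromX ++ʷ reverseʷ E-sym fromZ ,
    trans (len-++ʷ fromX _) (trans (cong₂ _+_ len-fromX (trans (len-reverseʷ E-sym fromZ) len-fromZ)) (sym dist))
    where
    P<r : length P < r
    P<r = subst (_< r) (sym |P|) (ancestorDepth<length lx lz x≢z)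
    fromX : Walk E (leaf _ lx) (inner false P P<r)
    fromX = climb false U P refl
    len-fromX : len E fromX ≡ suc (length U)
    len-fromX = len-climb false {α} U P {q = lx} refl
    fromZ : Walk E (leaf _ lz) (inner false P P<r)
    fromZ = climb false W P refl
    len-fromZ : len E fromZ ≡ suc (length W)
    len-fromZ = len-climb false {β} W P {q = lz} refl

  leaf-notBetween : ∀ {x y z lx ly lz} → x ≢ y → y ≢ z → x ≢ z →
                    ¬ Between (leaf x lx) (leaf y ly) (leaf z lz)
  leaf-notBetween {x} {y} {z} {lx} {ly} {lz} x≢y y≢z x≢z (m₁ , m₂ , geodesic) with leafShortcut lx lz x≢z
  ... | q , len-q = <-irrefl refl (begin-strict
    len E q                      ≡⟨ len-q ⟩
    treeDist x z                 <⟨ treeDist-strictTriangle lx ly lz x≢y y≢z ⟩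
    treeDist x y + treeDist y z  ≤⟨ +-mono-≤ (treeDist≤len m₁) (treeDist≤len m₂) ⟩
    len E m₁ + len E m₂          ≡⟨ len-++ʷ m₁ m₂ ⟨
    len E (m₁ ++ʷ m₂)            ≤⟨ geodesic q ⟩
    len E q                      ∎)
    where open ≤-Reasoning

  leafOf : Vec Bool r → V
  leafOf v = leaf (toList v) (Vec.length-toList v)

  leafOf-injective : ∀ {u v} → leafOf u ≡ leafOf v → u ≡ v
  leafOf-injective {u} {v} e =
    trans (sym (Vec.cast-is-id refl u)) (Vec.toList-injective refl u v (cong word e))

  leaves : List V
  leaves = map leafOf (boolVecs r)

  length-leaves : length leaves ≡ 2 ^ r
  length-leaves = trans (length-map leafOf (boolVecs r)) (length-boolVecs r)

  leaves-gpSet : IsGPSet E leaves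
  leaves-gpSet = gpSet-fromNoBetween leaves (map⁺ leafOf-injective (boolVecs-unique r)) noBetween
    where
    noBetween : ∀ {x y z} → x ∈ leaves → y ∈ leaves → z ∈ leaves → x ≢ y → y ≢ z → x ≢ z →
                ¬ Between x y z
    noBetween xL yL zL x≢y y≢z x≢z with ∈-map⁻ leafOf xL | ∈-map⁻ leafOf yL | ∈-map⁻ leafOf zL
    ... | _ , _ , refl | _ , _ , refl | _ , _ , refl =
      leaf-notBetween (x≢y ∘ leaf-≡) (y≢z ∘ leaf-≡) (x≢z ∘ leaf-≡)

module GluedTreeUpperBound (k : ℕ) where

  open GluedTree (suc (suc k))
  open WalkProperties E
  open TreeDistance Bool._≟_

  pad : List Bool → List Bool
  pad w = replicate (suc k ∸ length w) false ++ w

  length-pad : ∀ w → length w ≤ suc k → length (pad w) ≡ suc k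
  length-pad w |w|≤ = trans (length-++ (replicate (suc k ∸ length w) false))
    (trans (cong (_+ length w) (length-replicate (suc k ∸ length w))) (m∸n+n≡m |w|≤))

  -- index v = c ∷ canonicalTail y names a spine through v: y is the word of v padded with
  -- falses to length r - 1, or the word of a leaf v without its first letter.
  index : V → List Bool
  index (inner c w _) = c ∷ canonicalTail (pad w)
  index (leaf [] _) = []
  index (leaf (c ∷ y) _) = c ∷ canonicalTail y

  length-index : ∀ v → length (index v) ≡ suc k
  length-index (inner c w (s≤s |w|≤)) = cong suc (length-canonicalTail (pad w) (length-pad w |w|≤))
  length-index (leaf (c ∷ y) q) = cong suc (length-canonicalTail y (suc-injective q))

  root< : length {A = Bool} [] < suc (suc k)
  root< = s≤s z≤n

  leafToRoot : ∀ c y (ly : length y ≡ suc k) → Walk E (leaf (c ∷ y) (cong suc ly)) (inner c [] root<)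
  leafToRoot c y ly = climb c y [] (++-identityʳ y)

  len-leafToRoot : ∀ c y (ly : length y ≡ suc k) → len E (leafToRoot c y ly) ≡ suc (suc k)
  len-leafToRoot c y ly = trans (len-climb c {c} y [] {q = cong suc ly} {root<} (++-identityʳ y)) (cong suc ly)

  leafToRoot-visits : ∀ c y (ly : length y ≡ suc k) a {w q} → y ≡ a ++ w →
                      OnWalk E (inner c w q) (leafToRoot c y ly)
  leafToRoot-visits c y ly a y≡ = climb-visits y (++-identityʳ y) a y≡ (sym (++-identityʳ _))

  spine : ∀ c y (ly : length y ≡ suc k) →
          Walk E (leaf (c ∷ y) (cong suc ly)) (leaf (c ∷ map not y) (cong suc (trans (length-map not y) ly)))
  spine c y ly = leafToRoot c y ly ++ʷ reverseʷ E-sym (leafToRoot c (map not y) (trans (length-map not y) ly))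

  spine-geodesic : ∀ c y ly → IsGeodesic E (spine c y ly)
  spine-geodesic c y ly q = begin
    len E (spine c y ly)
      ≡⟨ len-++ʷ (leafToRoot c y ly) _ ⟩
    len E (leafToRoot c y ly) + len E (reverseʷ E-sym (leafToRoot c (map not y) ly′))
      ≡⟨ cong₂ _+_ (len-leafToRoot c y ly) (trans (len-reverseʷ E-sym _) (len-leafToRoot c (map not y) ly′)) ⟩
    suc (suc k) + suc (suc k)
      ≡⟨ cong (λ d → (suc (suc k) ∸ d) + (suc (suc k) ∸ d)) rootIsCommonAncestor ⟨
    (suc (suc k) ∸ ancestorDepth (c ∷ y) (c ∷ map not y)) + (suc (suc k) ∸ ancestorDepth (c ∷ y) (c ∷ map not y))
      ≡⟨ treeDist-sameLength {x = c ∷ y} {c ∷ map not y} (cong suc ly) (cong suc ly′) ⟨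
    treeDist (c ∷ y) (c ∷ map not y)
      ≤⟨ treeDist≤len q ⟩
    len E q ∎
    where
    open ≤-Reasoning
    ly′ : length (map not y) ≡ suc k
    ly′ = trans (length-map not y) ly
    rootIsCommonAncestor : ancestorDepth (c ∷ y) (c ∷ map not y) ≡ 0
    rootIsCommonAncestor = ancestorDepth-map-not c y (subst (0 <_) (sym ly) (s≤s z≤n))

  onSpine : ∀ v {c t} (e : length (false ∷ t) ≡ suc k) → index v ≡ c ∷ t →
            OnWalk E v (spine c (false ∷ t) e)
  onSpine (inner c w p) e refl with canonicalTail-spec (pad w) (length-pad w (≤-pred p))
  ... | inj₁ eq = onWalk-++⁺ˡ _ (leafToRoot-visits c _ e (replicate (suc k ∸ length w) false) (sym eq))
  ... | inj₂ eq = onWalk-++⁺ʳ (leafToRoot c _ e)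
                    (onWalk-reverseʷ E-sym (leafToRoot-visits c _ _ (replicate (suc k ∸ length w) false) (sym eq)))
  onSpine (leaf (c ∷ y) q) e refl with canonicalTail-spec y (suc-injective q)
  ... | inj₁ eq = here (leaf-≡ (cong (c ∷_) eq))
  ... | inj₂ eq = onWalk-end (spine c _ e) (leaf-≡ (cong (c ∷_) eq))

  sameIndex-onCommonGeodesic : ∀ {x y z} → index x ≡ index y → index y ≡ index z →
                               OnCommonGeodesic E x y z
  sameIndex-onCommonGeodesic {x} {y} {z} x~y y~z with index x in x≡ | length-index x
  ... | c ∷ t | e = _ , _ , spine c (false ∷ t) e , spine-geodesic c (false ∷ t) e ,
                    onSpine x e x≡ , onSpine y e (sym x~y) , onSpine z e (sym (trans x~y y~z))

  gpSet-length≤ : ∀ {S} → IsGPSet E S → length S ≤ 2 ^ suc (suc k)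
  gpSet-length≤ gp = pigeonhole-bits (suc k) index length-index (proj₁ gp)
                       (gpSet-atMostTwoPerFibre index sameIndex-onCommonGeodesic gp)

proposition3p8 : ∀ (r : ℕ) → 2 ≤ r → GPNumber (GTEdge {r}) (2 ^ r)
proposition3p8 (suc (suc k)) (s≤s (s≤s z≤n)) = (leaves , leaves-gpSet , length-leaves) , λ _ → gpSet-length≤
  where
  open GluedTree (suc (suc k))
  open GluedTreeUpperBound k
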